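{- For every positive integer $m$, the cyclotomic polytope $\mathcal{C}_m$ is a $\{0,+1,-1\}$-polytope (all vertex coordinates lie in $\{0,\pm1\}$) containing exactly one lattice point other than its vertices; this lattice point is the origin, and it lies in the interior of $\mathcal{C}_m$.
   Context: Cyclotomic polytopes are defined as follows. For $p$ prime, $\mathcal{C}_p=\operatorname{conv}(e_1,\dots,e_{p-1},-\sum_ie_i)\subset\mathbb{R}^{p-1}$. For $p$ prime and $\alpha\ge2$, with $\zeta=e^{2\pi i/p^\alpha}$, identify the $\mathbb{Z}$-basis element $\zeta^{k+jp^{\alpha-1}}$ ($0\le k\le p^{\alpha-1}-1$, $0\le j\le p-2$) of $\mathbb{Z}[\zeta]$ with $e_{k(p-1)+j}\in\mathbb{R}^{\phi(p^\alpha)}$, and let $\mathcal{C}_{p^\alpha}$ be the convex hull of the points representing all $p^\alpha$ powers of $\zeta$. For $m=m_1m_2$ with $m_1,m_2>1$ coprime, $\mathcal{C}_m=\mathcal{C}_{m_1}\otimes\mathcal{C}_{m_2}\subset\mathbb{R}^{\phi(m_1)}\otimes\mathbb{R}^{\phi(m_2)}=\mathbb{R}^{\phi(m)}$, where $P\otimes Q=\operatorname{conv}(v_i\otimes w_j)$ over vertices $v_i$ of $P$ and $w_j$ of $Q$. Equivalently $\mathcal{C}_m$ is the convex hull of the $m$-th roots of unity written in the product basis of $\mathbb{Z}[\zeta_m]$. -}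

module Defs where

open import Data.Nat as ℕ using (ℕ; zero; suc; _∸_; _^_)
open import Data.Nat.Primality using (Prime)
open import Data.Integer as ℤ using (ℤ; +_; -[1+_])
open import Data.Rational as ℚ using (ℚ; 0ℚ; 1ℚ)
open import Data.Fin using (Fin; zero; suc; toℕ; remQuot)
open import Data.Fin.Properties using (_≟_)
open import Data.Product using (Σ; Σ-syntax; _×_; _,_; proj₁; proj₂)
open import Data.List using (List; []; _∷_; map)
open import Data.Nat.ListAction using (product)
open import Data.Sum using (_⊎_)
open import Data.List.Relation.Unary.All using (All)
open import Data.List.Relation.Unary.AllPairs using (AllPairs)
open import Relation.Binary.PropositionalEquality using (_≡_; _≢_)
open import Relation.Nullary using (¬_; yes; no)
import Data.Nat.Properties as ℕP

-- A finite family of lattice points: N generating points in ℤ^d.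
-- The polytope it spans is the convex hull of these points.

record PointSet : Set where
  field
    N     : ℕ
    d     : ℕ
    point : Fin N → Fin d → ℤ
open PointSet public

-- With q = p^(α-1), the exponent n = k + j q (k < q, j < p) is indexed
-- by (k , j) ∈ Fin q × Fin p via remQuot (i.e. index k * p + j; the
-- ordering of generating points is irrelevant).  The coordinate index
-- k'(p-1)+j' ∈ Fin (q * (p-1)) is decoded via remQuot as (k' , j'),
-- exactly matching e_{k(p-1)+j}.
--   ζ^{k + j q} = e_{k(p-1)+j}                      if j ≤ p-2
--   ζ^{k + (p-1) q} = - Σ_{j'=0}^{p-2} e_{k(p-1)+j'}
-- For α = 1 this is C_p = conv(e_1,…,e_{p-1}, -Σ e_i).

ppCoord : (p : ℕ) {q : ℕ} → Fin q → Fin p → Fin q → Fin (p ∸ 1) → ℤ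
ppCoord p k j k' j' with k ≟ k'
... | no _  = + 0
... | yes _ with toℕ j ℕ.≟ (p ∸ 1)
...   | yes _ = -[1+ 0 ]
...   | no _ with toℕ j ℕ.≟ toℕ j'
...     | yes _ = + 1
...     | no _  = + 0

primePowerPoly : (p α : ℕ) → PointSet
primePowerPoly p α = record
  { N     = p ^ (α ∸ 1) ℕ.* p
  ; d     = p ^ (α ∸ 1) ℕ.* (p ∸ 1)
  ; point = λ n i →
      let (k , j)   = remQuot {p ^ (α ∸ 1)} p n
          (k' , j') = remQuot {p ^ (α ∸ 1)} (p ∸ 1) i
      in ppCoord p k j k' j'
  }

-- Tensor product P ⊗ Q = conv(v_i ⊗ w_j), coordinates of ℝ^a ⊗ ℝ^b
-- identified with ℝ^(a*b) via (r , s) ↦ r * b + s (remQuot).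

_⊗_ : PointSet → PointSet → PointSet
P ⊗ Q = record
  { N     = N P ℕ.* N Q
  ; d     = d P ℕ.* d Q
  ; point = λ n i →
      let (n₁ , n₂) = remQuot {N P} (N Q) n
          (i₁ , i₂) = remQuot {d P} (d Q) i
      in point P n₁ i₁ ℤ.* point Q n₂ i₂
  }

-- Cyclotomic polytope for m = p₁^α₁ ⋯ p_r^α_r (r ≥ 1), given as the
-- nonempty list of prime-power factors (p₁ , α₁) ∷ … :
--   C_m = C_{p₁^α₁} ⊗ (C_{p₂^α₂} ⊗ (⋯))

cyclotomic : ℕ × ℕ → List (ℕ × ℕ) → PointSet
cyclotomic (p , α) []       = primePowerPoly p α
cyclotomic (p , α) (f ∷ fs) = primePowerPoly p α ⊗ cyclotomic f fs

factorValue : List (ℕ × ℕ) → ℕ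
factorValue fs = product (map (λ f → proj₁ f ^ proj₂ f) fs)

ValidFactor : ℕ × ℕ → Set
ValidFactor (p , α) = Prime p × 1 ℕ.≤ α

sumFin : (n : ℕ) → (Fin n → ℚ) → ℚ
sumFin zero    f = 0ℚ
sumFin (suc n) f = f zero ℚ.+ sumFin n (λ i → f (suc i))

toℚ : ℤ → ℚ
toℚ z = z ℚ./ 1

IsConvComb : (S : PointSet) → (Fin (N S) → ℚ) → (Fin (d S) → ℚ) → Set
IsConvComb S λ′ x =
  (∀ i → 0ℚ ℚ.≤ λ′ i) ×
  (sumFin (N S) λ′ ≡ 1ℚ) ×
  (∀ c → sumFin (N S) (λ i → λ′ i ℚ.* toℚ (point S i c)) ≡ x c)

InConv : (S : PointSet) → (Fin (d S) → ℚ) → Set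
InConv S x = Σ[ λ′ ∈ (Fin (N S) → ℚ) ] IsConvComb S λ′ x

IsVertex : (S : PointSet) → (Fin (d S) → ℚ) → Set
IsVertex S x =
  InConv S x ×
  ¬ (Σ[ λ′ ∈ (Fin (N S) → ℚ) ]
       IsConvComb S λ′ x ×
       (∀ j → (∀ c → toℚ (point S j c) ≡ x c) → λ′ j ≡ 0ℚ))

InInterior : (S : PointSet) → (Fin (d S) → ℚ) → Set
InInterior S x =
  Σ[ ε ∈ ℚ ] (0ℚ ℚ.< ε) ×
    (∀ (y : Fin (d S) → ℚ) →
       (∀ c → (x c ℚ.- ε ℚ.≤ y c) × (y c ℚ.≤ x c ℚ.+ ε)) →
       InConv S y)

latticeToℚ : {n : ℕ} → (Fin n → ℤ) → (Fin n → ℚ)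
latticeToℚ z c = toℚ (z c)

origin : {n : ℕ} → Fin n → ℚ
origin _ = 0ℚ

CyclotomicConclusion : PointSet → Set
CyclotomicConclusion S =
  (∀ x → IsVertex S x → ∀ c → (x c ≡ 0ℚ) ⊎ ((x c ≡ 1ℚ) ⊎ (x c ≡ ℚ.- 1ℚ))) ×
  (∀ (z : Fin (d S) → ℤ) → InConv S (latticeToℚ z) → ¬ IsVertex S (latticeToℚ z) →
     ∀ c → z c ≡ + 0) ×
  (¬ IsVertex S origin) × InInterior S origin

-- C_m is built as C_{p^α} ⊗ R, where R is a smaller cyclotomic polytope or, at the bottom, the
-- point 1 ∈ ℝ¹.  The points of C_{p^α} ⊗ R are e_{k,j} ⊗ w with e_{k,j} (j < p - 1) unit vectors
-- and e_{k,p-1} = -Σ_j e_{k,j}, so on the coordinate block (k, j) a combination Σ λ v equals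
-- W_{k,j} - W_{k,p-1}, where W_{k,j} is the combination of R with the weights sitting on (k, j).
--
-- All coordinates lie in {0, ±1}, hence so do the vertices, and writing a nonzero lattice point
-- z as Σ (λ⁺ - λ⁻) v needs total weight Σ (λ⁺ + λ⁻) ≥ 1.  When the weight is exactly 1, the
-- block formula shows inductively that only copies of z (and of -z, with λ⁻) occur; for a convex
-- combination this makes every nonzero lattice point of C_m a vertex.  No point is 0, so the
-- origin is not a vertex; it is interior because the points sum to 0 and every small vector is
-- a combination of the points with equally small coefficients, which can be added to the uniform
-- weights.

module Submission where

open import Defs
open import Algebra.Bundles using (CommutativeRing)
open import Data.Empty using (⊥-elim)
open import Data.Fin as Fin
  using (Fin; zero; suc; fromℕ; inject₁; combine; remQuot; punchIn; punchOut; _↑ˡ_; _↑ʳ_)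
import Data.Fin.Properties as FinP
open import Data.Fin.Relation.Unary.Top using (view; ‵fromℕ; ‵inject₁; view-fromℕ; view-inject₁)
open import Data.Integer as ℤ using (ℤ; -[1+_])
import Data.Integer.Properties as ℤP
import Data.Nat.Properties as ℕP
open import Data.Nat as ℕ using (ℕ; zero; suc)
open import Data.Nat.Coprimality using (1-coprimeTo) renaming (sym to coprime-sym)
open import Data.Nat.Primality using (¬prime[0]; ¬prime[1])
open import Data.List using (List; []; _∷_; map)
open import Data.List.Relation.Unary.All using (All; _∷_)
open import Data.List.Relation.Unary.AllPairs using (AllPairs)
open import Data.Product using (Σ-syntax; ∃-syntax; _×_; _,_; proj₁; proj₂)
open import Data.Rational as ℚ using (ℚ; 0ℚ; 1ℚ; mkℚ; _+_; _*_; _-_; -_; _≤_; _<_)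
import Data.Rational.Properties as ℚP
open import Data.Rational.Solver using (module +-*-Solver)
open import Data.Sum using (_⊎_; inj₁; inj₂; [_,_]′)
open import Data.Vec.Functional using (removeAt)
open import Function using (_∘_)
open import Relation.Binary.PropositionalEquality
open import Relation.Nullary using (¬_; yes; no)

open +-*-Solver using (solve; _:=_; con; _:+_; _:*_; _:-_; :-_)
open import Algebra.Properties.Semiring.Sum (CommutativeRing.semiring ℚP.+-*-commutativeRing)
  using (sum; sum-cong-≗; ∑-distrib-+; *-distribˡ-sum; sum-remove; sum-init-last; sum-replicate-zero)

-- Integers and order in ℚ

toℚ≡mkℚ : ∀ z → toℚ z ≡ mkℚ z 0 (coprime-sym (1-coprimeTo _))
toℚ≡mkℚ (ℤ.+ n)  = ℚP.normalize-coprime (coprime-sym (1-coprimeTo n))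
toℚ≡mkℚ -[1+ n ] = cong -_ (ℚP.normalize-coprime (coprime-sym (1-coprimeTo (suc n))))

toℚ-injective : ∀ {a b} → toℚ a ≡ toℚ b → a ≡ b
toℚ-injective {a} {b} eq = begin
  a                 ≡⟨ cong ℚ.↥_ (toℚ≡mkℚ a) ⟨
  ℚ.↥ (toℚ a)       ≡⟨ cong ℚ.↥_ eq ⟩
  ℚ.↥ (toℚ b)       ≡⟨ cong ℚ.↥_ (toℚ≡mkℚ b) ⟩
  b                 ∎
  where open ≡-Reasoning

toℚ-homo-+ : ∀ a b → toℚ (a ℤ.+ b) ≡ toℚ a + toℚ b
toℚ-homo-+ a b rewrite toℚ≡mkℚ a | toℚ≡mkℚ b =
  cong toℚ (sym (cong₂ ℤ._+_ (ℤP.*-identityʳ a) (ℤP.*-identityʳ b)))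

toℚ-homo-* : ∀ a b → toℚ (a ℤ.* b) ≡ toℚ a * toℚ b
toℚ-homo-* a b rewrite toℚ≡mkℚ a | toℚ≡mkℚ b = refl

toℚ-homo-neg : ∀ a → toℚ (ℤ.- a) ≡ - toℚ a
toℚ-homo-neg a rewrite toℚ≡mkℚ a | toℚ≡mkℚ (ℤ.- a) with a
... | ℤ.+ zero  = refl
... | ℤ.+ suc n = refl
... | -[1+ n ]  = refl

toℚ-mono-≤ : ∀ {a b} → a ℤ.≤ b → toℚ a ≤ toℚ b
toℚ-mono-≤ {a} {b} a≤b rewrite toℚ≡mkℚ a | toℚ≡mkℚ b =
  ℚ.*≤* (subst₂ ℤ._≤_ (sym (ℤP.*-identityʳ a)) (sym (ℤP.*-identityʳ b)) a≤b)

nonzero⇒1≤±toℚ : ∀ {z} → z ≢ ℤ.0ℤ → 1ℚ ≤ toℚ z ⊎ 1ℚ ≤ - toℚ z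
nonzero⇒1≤±toℚ {ℤ.+ zero}  z≢0 = ⊥-elim (z≢0 refl)
nonzero⇒1≤±toℚ {ℤ.+ suc n} _   = inj₁ (toℚ-mono-≤ {ℤ.+ 1} {ℤ.+ suc n} (ℤ.+≤+ (ℕ.s≤s ℕ.z≤n)))
nonzero⇒1≤±toℚ { -[1+ n ]} _   = inj₂ (ℚP.neg-antimono-≤ (toℚ-mono-≤ { -[1+ n ]} { -[1+ 0 ]} (ℤ.-≤- ℕ.z≤n)))

p≤p+q : ∀ {p q} → 0ℚ ≤ q → p ≤ p + q
p≤p+q {p} {q} q≥0 = subst (_≤ p + q) (ℚP.+-identityʳ p) (ℚP.+-monoʳ-≤ p q≥0)

nonneg-+≤0 : ∀ {p q} → 0ℚ ≤ p → 0ℚ ≤ q → p + q ≤ 0ℚ → p ≡ 0ℚ × q ≡ 0ℚ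
nonneg-+≤0 {p} {q} p≥0 q≥0 p+q≤0 =
  ℚP.≤-antisym (ℚP.≤-trans (p≤p+q q≥0) p+q≤0) p≥0 ,
  ℚP.≤-antisym (ℚP.≤-trans (subst (q ≤_) (ℚP.+-comm q p) (p≤p+q p≥0)) p+q≤0) q≥0

-p≤p : ∀ {p} → 0ℚ ≤ p → - p ≤ p
-p≤p p≥0 = ℚP.≤-trans (ℚP.neg-antimono-≤ p≥0) p≥0

p+q≤p⇒q≤0 : ∀ {p q} → p + q ≤ p → q ≤ 0ℚ
p+q≤p⇒q≤0 {p} {q} p+q≤p = subst₂ _≤_
  (solve 2 (λ p q → p :+ q :- p := q) refl p q) (ℚP.+-inverseʳ p) (ℚP.+-monoˡ-≤ (- p) p+q≤p)

-- Finite sums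

sumFin≡sum : ∀ n (f : Fin n → ℚ) → sumFin n f ≡ sum f
sumFin≡sum zero    f = refl
sumFin≡sum (suc n) f = cong (f zero +_) (sumFin≡sum n (f ∘ suc))

sum-nonneg : ∀ {n} {f : Fin n → ℚ} → (∀ i → 0ℚ ≤ f i) → 0ℚ ≤ sum f
sum-nonneg {zero}  f≥0 = ℚP.≤-refl
sum-nonneg {suc n} f≥0 = ℚP.+-mono-≤ (f≥0 zero) (sum-nonneg (f≥0 ∘ suc))

sum-mono-≤ : ∀ {n} {f g : Fin n → ℚ} → (∀ i → f i ≤ g i) → sum f ≤ sum g
sum-mono-≤ {zero}  f≤g = ℚP.≤-refl
sum-mono-≤ {suc n} f≤g = ℚP.+-mono-≤ (f≤g zero) (sum-mono-≤ (f≤g ∘ suc))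

sum-const : ∀ n (x : ℚ) → sum {n} (λ _ → x) ≡ toℚ (ℤ.+ n) * x
sum-const zero    x = sym (ℚP.*-zeroˡ x)
sum-const (suc n) x = begin
  x + sum {n} (λ _ → x)   ≡⟨ cong (x +_) (sum-const n x) ⟩
  x + toℚ (ℤ.+ n) * x     ≡⟨ solve 2 (λ x m → x :+ m :* x := (con 1ℚ :+ m) :* x) refl x (toℚ (ℤ.+ n)) ⟩
  (1ℚ + toℚ (ℤ.+ n)) * x  ≡⟨ cong (_* x) (toℚ-homo-+ (ℤ.+ 1) (ℤ.+ n)) ⟨
  toℚ (ℤ.+ suc n) * x     ∎
  where open ≡-Reasoning

sum-splitAt : ∀ m {n} (f : Fin (m ℕ.+ n) → ℚ) → sum f ≡ sum (f ∘ (_↑ˡ n)) + sum (f ∘ (m ↑ʳ_))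
sum-splitAt zero    f = sym (ℚP.+-identityˡ _)
sum-splitAt (suc m) {n} f = trans (cong (f zero +_) (sum-splitAt m (f ∘ suc)))
  (sym (ℚP.+-assoc (f zero) (sum (f ∘ suc ∘ (_↑ˡ n))) (sum (f ∘ suc ∘ (m ↑ʳ_)))))

sum-combine : ∀ m {n} (f : Fin (m ℕ.* n) → ℚ) → sum f ≡ sum {m} (λ i → sum {n} (λ j → f (combine i j)))
sum-combine zero    f = refl
sum-combine (suc m) {n} f =
  trans (sum-splitAt n f) (cong (sum {n} (λ j → f (j ↑ˡ m ℕ.* n)) +_) (sum-combine m (f ∘ (n ↑ʳ_))))

sum-single : ∀ {n} {f : Fin n → ℚ} i → (∀ j → j ≢ i → f j ≡ 0ℚ) → sum f ≡ f i
sum-single {suc n} {f} i others = begin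
  sum f                     ≡⟨ sum-remove {i = i} f ⟩
  f i + sum (removeAt f i)  ≡⟨ cong (f i +_) rest≡0 ⟩
  f i + 0ℚ                  ≡⟨ ℚP.+-identityʳ (f i) ⟩
  f i                       ∎
  where
  open ≡-Reasoning
  rest≡0 : sum (removeAt f i) ≡ 0ℚ
  rest≡0 = trans (sum-cong-≗ (λ j → others (punchIn i j) (FinP.punchInᵢ≢i i j))) (sum-replicate-zero n)

removeAt-punchOut : ∀ {n} (f : Fin (suc n) → ℚ) {i j} (i≢j : i ≢ j) → removeAt f i (punchOut i≢j) ≡ f j
removeAt-punchOut f i≢j = cong f (FinP.punchIn-punchOut i≢j)

term≤sum : ∀ {n} {f : Fin n → ℚ} → (∀ i → 0ℚ ≤ f i) → ∀ i → f i ≤ sum f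
term≤sum {suc n} {f} f≥0 i = begin
  f i                       ≤⟨ p≤p+q (sum-nonneg (f≥0 ∘ punchIn i)) ⟩
  f i + sum (removeAt f i)  ≡⟨ sum-remove {i = i} f ⟨
  sum f                     ∎
  where open ℚP.≤-Reasoning

pair≤sum : ∀ {n} {f : Fin n → ℚ} → (∀ i → 0ℚ ≤ f i) → ∀ {i j} → i ≢ j → f i + f j ≤ sum f
pair≤sum {suc n} {f} f≥0 {i} {j} i≢j = begin
  f i + f j                          ≡⟨ cong (f i +_) (removeAt-punchOut f i≢j) ⟨
  f i + removeAt f i (punchOut i≢j)  ≤⟨ ℚP.+-monoʳ-≤ (f i) (term≤sum (f≥0 ∘ punchIn i) (punchOut i≢j)) ⟩
  f i + sum (removeAt f i)           ≡⟨ sum-remove {i = i} f ⟨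
  sum f                              ∎
  where open ℚP.≤-Reasoning

triple≤sum : ∀ {n} {f : Fin n → ℚ} → (∀ i → 0ℚ ≤ f i) →
             ∀ {i j k} → i ≢ j → i ≢ k → j ≢ k → f i + f j + f k ≤ sum f
triple≤sum {suc n} {f} f≥0 {i} {j} {k} i≢j i≢k j≢k = begin
  f i + f j + f k
    ≡⟨ ℚP.+-assoc (f i) (f j) (f k) ⟩
  f i + (f j + f k)
    ≡⟨ cong (f i +_) (cong₂ _+_ (removeAt-punchOut f i≢j) (removeAt-punchOut f i≢k)) ⟨
  f i + (removeAt f i (punchOut i≢j) + removeAt f i (punchOut i≢k))
    ≤⟨ ℚP.+-monoʳ-≤ (f i) (pair≤sum (f≥0 ∘ punchIn i) (j≢k ∘ FinP.punchOut-injective i≢j i≢k)) ⟩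
  f i + sum (removeAt f i)
    ≡⟨ sum-remove {i = i} f ⟨
  sum f
    ∎
  where open ℚP.≤-Reasoning

sum≤term⇒rest≡0 : ∀ {n} {f : Fin n → ℚ} → (∀ i → 0ℚ ≤ f i) →
                  ∀ {i} → sum f ≤ f i → ∀ j → i ≢ j → f j ≡ 0ℚ
sum≤term⇒rest≡0 f≥0 sum≤fi j i≢j =
  ℚP.≤-antisym (p+q≤p⇒q≤0 (ℚP.≤-trans (pair≤sum f≥0 i≢j) sum≤fi)) (f≥0 j)

sum≤pair⇒rest≡0 : ∀ {n} {f : Fin n → ℚ} → (∀ i → 0ℚ ≤ f i) →
                  ∀ {i j} → i ≢ j → sum f ≤ f i + f j → ∀ k → i ≢ k → j ≢ k → f k ≡ 0ℚ
sum≤pair⇒rest≡0 f≥0 i≢j sum≤fij k i≢k j≢k =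
  ℚP.≤-antisym (p+q≤p⇒q≤0 (ℚP.≤-trans (triple≤sum f≥0 i≢j i≢k j≢k) sum≤fij)) (f≥0 k)

-- Linear and signed combinations of the generating points

lincomb : (S : PointSet) → (Fin (N S) → ℚ) → Fin (d S) → ℚ
lincomb S L c = sum (λ n → L n * toℚ (point S n c))

module _ (S : PointSet) where

  lincomb-cong : ∀ {L L′} → (∀ n → L n ≡ L′ n) → ∀ c → lincomb S L c ≡ lincomb S L′ c
  lincomb-cong L≗L′ c = sum-cong-≗ (λ n → cong (_* toℚ (point S n c)) (L≗L′ n))

  lincomb-zero : ∀ c → lincomb S (λ _ → 0ℚ) c ≡ 0ℚ
  lincomb-zero c = trans (sum-cong-≗ (λ n → ℚP.*-zeroˡ (toℚ (point S n c)))) (sum-replicate-zero (N S))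

  lincomb-+ : ∀ L L′ c → lincomb S (λ n → L n + L′ n) c ≡ lincomb S L c + lincomb S L′ c
  lincomb-+ L L′ c =
    trans (sum-cong-≗ (λ n → ℚP.*-distribʳ-+ (v n) (L n) (L′ n)))
          (∑-distrib-+ (λ n → L n * v n) (λ n → L′ n * v n))
    where
    v : Fin (N S) → ℚ
    v n = toℚ (point S n c)

  lincomb-* : ∀ a L c → lincomb S (λ n → a * L n) c ≡ a * lincomb S L c
  lincomb-* a L c =
    trans (sum-cong-≗ (λ n → ℚP.*-assoc a (L n) (v n))) (sym (*-distribˡ-sum a (λ n → L n * v n)))
    where
    v : Fin (N S) → ℚ
    v n = toℚ (point S n c)

  lincomb-const : ∀ a c → lincomb S (λ _ → a) c ≡ a * lincomb S (λ _ → 1ℚ) c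
  lincomb-const a c = trans (lincomb-cong (λ _ → sym (ℚP.*-identityʳ a)) c) (lincomb-* a (λ _ → 1ℚ) c)

  lincomb-neg : ∀ L c → lincomb S (λ n → - L n) c ≡ - lincomb S L c
  lincomb-neg L c = begin
    lincomb S (λ n → - L n) c        ≡⟨ lincomb-cong (λ n → -p≡-1*p (L n)) c ⟩
    lincomb S (λ n → - 1ℚ * L n) c   ≡⟨ lincomb-* (- 1ℚ) L c ⟩
    - 1ℚ * lincomb S L c             ≡⟨ -p≡-1*p (lincomb S L c) ⟨
    - lincomb S L c                  ∎
    where
    open ≡-Reasoning
    -p≡-1*p : ∀ p → - p ≡ - 1ℚ * p
    -p≡-1*p = solve 1 (λ p → :- p := :- con 1ℚ :* p) refl

  lincomb-- : ∀ L L′ c → lincomb S (λ n → L n - L′ n) c ≡ lincomb S L c - lincomb S L′ c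
  lincomb-- L L′ c =
    trans (lincomb-+ L (λ n → - L′ n) c) (cong (lincomb S L c +_) (lincomb-neg L′ c))

-- (lp, lm) exhibits y as a point of t · conv(±S)
record SignedComb (S : PointSet) (lp lm : Fin (N S) → ℚ) (t : ℚ) (y : Fin (d S) → ℚ) : Set where
  field
    lp≥0       : ∀ n → 0ℚ ≤ lp n
    lm≥0       : ∀ n → 0ℚ ≤ lm n
    mass       : sum (λ n → lp n + lm n) ≡ t
    represents : ∀ c → lincomb S (λ n → lp n - lm n) c ≡ y c

module _ {S : PointSet} where

  SignedComb-swap : ∀ {lp lm t y} → SignedComb S lp lm t y → SignedComb S lm lp t (λ c → - y c)
  SignedComb-swap {lp} {lm} comb = record
    { lp≥0       = lm≥0
    ; lm≥0       = lp≥0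
    ; mass       = trans (sum-cong-≗ (λ n → ℚP.+-comm (lm n) (lp n))) mass
    ; represents = λ c → trans (lincomb-cong S (λ n → flip (lp n) (lm n)) c)
                         (trans (lincomb-neg S (λ n → lp n - lm n) c) (cong -_ (represents c)))
    }
    where
    open SignedComb comb
    flip : ∀ p q → q - p ≡ - (p - q)
    flip = solve 2 (λ p q → q :- p := :- (p :- q)) refl

  convComb⇒signedComb : ∀ {μ x} → IsConvComb S μ x → SignedComb S μ (λ _ → 0ℚ) 1ℚ x
  convComb⇒signedComb {μ} (μ≥0 , μ-sum , μ-comb) = record
    { lp≥0       = μ≥0
    ; lm≥0       = λ _ → ℚP.≤-refl
    ; mass       = trans (sum-cong-≗ (λ n → ℚP.+-identityʳ (μ n)))
                         (trans (sym (sumFin≡sum (N S) μ)) μ-sum)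
    ; represents = λ c → trans (lincomb-cong S (λ n → ℚP.+-identityʳ (μ n)) c)
                         (trans (sym (sumFin≡sum (N S) _)) (μ-comb c))
    }

-- {0, ±1}-point sets

Is0±1 : ℤ → Set
Is0±1 z = z ≡ ℤ.0ℤ ⊎ z ≡ ℤ.1ℤ ⊎ z ≡ ℤ.-1ℤ

UnitCoordinates : PointSet → Set
UnitCoordinates S = ∀ n c → Is0±1 (point S n c)

Is0±1-* : ∀ {a b} → Is0±1 a → Is0±1 b → Is0±1 (a ℤ.* b)
Is0±1-* (inj₁ refl)        _                  = inj₁ refl
Is0±1-* (inj₂ (inj₁ refl)) b                  = subst Is0±1 (sym (ℤP.*-identityˡ _)) b
Is0±1-* (inj₂ (inj₂ refl)) (inj₁ refl)        = inj₁ refl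
Is0±1-* (inj₂ (inj₂ refl)) (inj₂ (inj₁ refl)) = inj₂ (inj₂ refl)
Is0±1-* (inj₂ (inj₂ refl)) (inj₂ (inj₂ refl)) = inj₂ (inj₁ refl)

diff*unit≤sum : ∀ {a b z} → 0ℚ ≤ a → 0ℚ ≤ b → Is0±1 z → (a - b) * toℚ z ≤ a + b
diff*unit≤sum {a} {b} a≥0 b≥0 (inj₁ refl) =
  subst (_≤ a + b) (sym (ℚP.*-zeroʳ (a - b))) (ℚP.+-mono-≤ a≥0 b≥0)
diff*unit≤sum {a} {b} a≥0 b≥0 (inj₂ (inj₁ refl)) =
  subst (_≤ a + b) (sym (ℚP.*-identityʳ (a - b))) (ℚP.+-monoʳ-≤ a (-p≤p b≥0))
diff*unit≤sum {a} {b} a≥0 b≥0 (inj₂ (inj₂ refl)) =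
  subst₂ _≤_ (solve 2 (λ a b → b :- a := (a :- b) :* :- con 1ℚ) refl a b) (ℚP.+-comm b a)
    (ℚP.+-monoʳ-≤ b (-p≤p a≥0))

module _ {S : PointSet} (unit : UnitCoordinates S) where

  coord≤mass : ∀ {lp lm t y} → SignedComb S lp lm t y → ∀ c → y c ≤ t
  coord≤mass {lp} {lm} {t} {y} comb c = begin
    y c                                            ≡⟨ represents c ⟨
    sum (λ n → (lp n - lm n) * toℚ (point S n c))
      ≤⟨ sum-mono-≤ (λ n → diff*unit≤sum (lp≥0 n) (lm≥0 n) (unit n c)) ⟩
    sum (λ n → lp n + lm n)                        ≡⟨ mass ⟩
    t                                              ∎
    where
    open SignedComb comb
    open ℚP.≤-Reasoning

  mass≥1 : ∀ {lp lm t y} → SignedComb S lp lm t y → ∀ c {z} → y c ≡ toℚ z → z ≢ ℤ.0ℤ → 1ℚ ≤ t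
  mass≥1 comb c y≡z z≢0 with nonzero⇒1≤±toℚ z≢0
  ... | inj₁ 1≤z  = ℚP.≤-trans 1≤z (subst (_≤ _) y≡z (coord≤mass comb c))
  ... | inj₂ 1≤-z = ℚP.≤-trans 1≤-z (subst (_≤ _) (cong -_ y≡z) (coord≤mass (SignedComb-swap comb) c))

-- Vertices, lattice points and the origin

toℚ-Is0±1 : ∀ {z} → Is0±1 z → toℚ z ≡ 0ℚ ⊎ toℚ z ≡ 1ℚ ⊎ toℚ z ≡ - 1ℚ
toℚ-Is0±1 (inj₁ refl)        = inj₁ refl
toℚ-Is0±1 (inj₂ (inj₁ refl)) = inj₂ (inj₁ refl)
toℚ-Is0±1 (inj₂ (inj₂ refl)) = inj₂ (inj₂ refl)

vertex⇒point : ∀ {S x} → IsVertex S x → ∃[ n ] ∀ c → toℚ (point S n c) ≡ x c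
vertex⇒point {S} {x} ((μ , comb) , unavoidable)
  with FinP.any? (λ n → FinP.all? (λ c → toℚ (point S n c) ℚP.≟ x c))
... | yes found = found
... | no  none  = ⊥-elim (unavoidable (μ , comb , λ n n≡x → ⊥-elim (none (n , n≡x))))

UnitMassRigid : PointSet → Set
UnitMassRigid S = ∀ {lp lm y} (w : Fin (d S) → ℤ) → SignedComb S lp lm 1ℚ y → (∀ c → y c ≡ toℚ (w c)) →
  ∀ c → w c ≢ ℤ.0ℤ → ∀ n → lp n ≢ 0ℚ → ∀ c′ → point S n c′ ≡ w c′

NonzeroPoints : PointSet → Set
NonzeroPoints S = ∀ n → ∃[ c ] point S n c ≢ ℤ.0ℤ

module _ {S : PointSet} where

  UnitMassRigid-neg : UnitMassRigid S → ∀ {lp lm y} (w : Fin (d S) → ℤ) → SignedComb S lp lm 1ℚ y →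
    (∀ c → y c ≡ toℚ (w c)) → ∀ c → w c ≢ ℤ.0ℤ → ∀ n → lm n ≢ 0ℚ → ∀ c′ → ℤ.- point S n c′ ≡ w c′
  UnitMassRigid-neg rigid {y = y} w comb y≡w c w≢0 n lm≢0 c′ = begin
    ℤ.- point S n c′   ≡⟨ cong ℤ.-_ (rigid (ℤ.-_ ∘ w) (SignedComb-swap comb) -y≡-w c -w≢0 n lm≢0 c′) ⟩
    ℤ.- ℤ.- w c′       ≡⟨ ℤP.neg-involutive (w c′) ⟩
    w c′               ∎
    where
    open ≡-Reasoning
    -y≡-w : ∀ c → - y c ≡ toℚ (ℤ.- w c)
    -y≡-w c = trans (cong -_ (y≡w c)) (sym (toℚ-homo-neg (w c)))
    -w≢0 : ℤ.- w c ≢ ℤ.0ℤ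
    -w≢0 -w≡0 = w≢0 (trans (sym (ℤP.neg-involutive (w c))) (cong ℤ.-_ -w≡0))

  nonzeroLatticePoint-isVertex : UnitMassRigid S → ∀ z → InConv S (latticeToℚ z) →
    ∀ c → z c ≢ ℤ.0ℤ → IsVertex S (latticeToℚ z)
  nonzeroLatticePoint-isVertex rigid z inConv c z≢0 = inConv , λ (μ , comb@(_ , μ-sum , _) , avoids) →
    ℚP.1≢0 (begin
      1ℚ                    ≡⟨ μ-sum ⟨
      sumFin (N S) μ        ≡⟨ sumFin≡sum (N S) μ ⟩
      sum μ                 ≡⟨ sum-cong-≗ (μ≡0 μ comb avoids) ⟩
      sum {N S} (λ _ → 0ℚ)  ≡⟨ sum-replicate-zero (N S) ⟩
      0ℚ                    ∎)
    where
    open ≡-Reasoning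
    μ≡0 : ∀ μ → (comb : IsConvComb S μ (latticeToℚ z)) →
          (∀ n → (∀ c → toℚ (point S n c) ≡ toℚ (z c)) → μ n ≡ 0ℚ) → ∀ n → μ n ≡ 0ℚ
    μ≡0 μ comb avoids n with μ n ℚP.≟ 0ℚ
    ... | yes μn≡0 = μn≡0
    ... | no  μn≢0 = avoids n (λ c′ →
          cong toℚ (rigid z (convComb⇒signedComb comb) (λ _ → refl) c z≢0 n μn≢0 c′))

  origin-notVertex : NonzeroPoints S → ¬ IsVertex S origin
  origin-notVertex nonzero ((μ , comb) , unavoidable) = unavoidable (μ , comb , λ n n≡0 →
    ⊥-elim (proj₂ (nonzero n) (toℚ-injective (n≡0 (proj₁ (nonzero n))))))

-- The origin as an interior point

-- The cube of InInterior around the origin.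
Bounded : ∀ {n} → ℚ → (Fin n → ℚ) → Set
Bounded ε y = ∀ i → (0ℚ - ε ≤ y i) × (y i ≤ 0ℚ + ε)

BoundedSpanning : PointSet → Set
BoundedSpanning S = ∀ {ε} → 0ℚ ≤ ε → ∀ y → Bounded ε y →
  Σ[ β ∈ (Fin (N S) → ℚ) ] Bounded ε β × (∀ c → lincomb S β c ≡ y c)

reciprocal : ∀ {k} → Fin k → Σ[ u ∈ ℚ ] 0ℚ < u × toℚ (ℤ.+ k) * u ≡ 1ℚ
reciprocal {suc m} _ rewrite toℚ≡mkℚ (ℤ.+ suc m) =
  ℚ.1/ k , ℚP.positive⁻¹ _ {{ℚP.1/pos⇒pos k}} , ℚP.*-inverseʳ k
  where
  k : ℚ
  k = mkℚ (ℤ.+ suc m) 0 (coprime-sym (1-coprimeTo _))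

module ShiftedWeights (S : PointSet) {u : ℚ} (Nu≡1 : toℚ (ℤ.+ N S) * u ≡ 1ℚ) (β : Fin (N S) → ℚ) where

  private
    Nℚ σ : ℚ
    Nℚ = toℚ (ℤ.+ N S)
    σ  = sum β

  weight : Fin (N S) → ℚ
  weight n = (1ℚ - σ) * u + β n

  weight-sum : sum weight ≡ 1ℚ
  weight-sum = begin
    sum weight                          ≡⟨ ∑-distrib-+ (λ _ → (1ℚ - σ) * u) β ⟩
    sum {N S} (λ _ → (1ℚ - σ) * u) + σ  ≡⟨ cong (_+ σ) (sum-const (N S) ((1ℚ - σ) * u)) ⟩
    Nℚ * ((1ℚ - σ) * u) + σ             ≡⟨ solve 3 (λ N σ u → N :* ((con 1ℚ :- σ) :* u) :+ σ
                                                     := (con 1ℚ :- σ) :* (N :* u) :+ σ) refl Nℚ σ u ⟩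
    (1ℚ - σ) * (Nℚ * u) + σ             ≡⟨ cong (λ x → (1ℚ - σ) * x + σ) Nu≡1 ⟩
    (1ℚ - σ) * 1ℚ + σ                   ≡⟨ solve 1 (λ σ → (con 1ℚ :- σ) :* con 1ℚ :+ σ := con 1ℚ) refl σ ⟩
    1ℚ                                  ∎
    where open ≡-Reasoning

  weight-comb : (∀ c → lincomb S (λ _ → 1ℚ) c ≡ 0ℚ) → ∀ c → lincomb S weight c ≡ lincomb S β c
  weight-comb barycentre c = begin
    lincomb S weight c                          ≡⟨ lincomb-+ S (λ _ → a) β c ⟩
    lincomb S (λ _ → a) c + βc                  ≡⟨ cong (_+ βc) (lincomb-const S a c) ⟩
    a * lincomb S (λ _ → 1ℚ) c + βc             ≡⟨ cong (λ x → a * x + βc) (barycentre c) ⟩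
    a * 0ℚ + βc                                 ≡⟨ cong (_+ βc) (ℚP.*-zeroʳ a) ⟩
    0ℚ + βc                                     ≡⟨ ℚP.+-identityˡ βc ⟩
    βc                                          ∎
    where
    open ≡-Reasoning
    a βc : ℚ
    a  = (1ℚ - σ) * u
    βc = lincomb S β c

  -- σ ≤ N ε = 1/2, so the uniform part (1 - σ) u is at least u/2 = ε, which absorbs β n ≥ -ε.
  weight≥0 : 0ℚ ≤ u → Bounded (u * ℚ.½) β → ∀ n → 0ℚ ≤ weight n
  weight≥0 u≥0 β-small n = begin
    0ℚ                                   ≡⟨ ℚP.*-zeroʳ ε ⟨
    ε * (1ℚ - 1ℚ)                        ≡⟨ cong (λ x → ε * (1ℚ - x)) Nu≡1 ⟨
    ε * (1ℚ - Nℚ * u)                    ≡⟨ solve 2 (λ N u → u :* con ℚ.½ :* (con 1ℚ :- N :* u)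
                                                   := (con 1ℚ :- N :* (con 0ℚ :+ u :* con ℚ.½)) :* u
                                                      :+ (con 0ℚ :- u :* con ℚ.½)) refl Nℚ u ⟩
    (1ℚ - Nℚ * (0ℚ + ε)) * u + (0ℚ - ε)  ≤⟨ ℚP.+-mono-≤ uniform-bound (proj₁ (β-small n)) ⟩
    weight n                             ∎
    where
    open ℚP.≤-Reasoning
    ε : ℚ
    ε = u * ℚ.½
    σ≤Nε : σ ≤ Nℚ * (0ℚ + ε)
    σ≤Nε = subst (σ ≤_) (sum-const (N S) (0ℚ + ε)) (sum-mono-≤ (proj₂ ∘ β-small))
    uniform-bound : (1ℚ - Nℚ * (0ℚ + ε)) * u ≤ (1ℚ - σ) * u
    uniform-bound = ℚP.*-monoʳ-≤-nonNeg u {{ℚ.nonNegative u≥0}} (ℚP.+-monoʳ-≤ 1ℚ (ℚP.neg-antimono-≤ σ≤Nε))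

-- The origin is the barycentre, and a small y is reached by shifting the uniform weights by
-- short coefficients of y.
origin-interior : ∀ S → (∀ c → lincomb S (λ _ → 1ℚ) c ≡ 0ℚ) → BoundedSpanning S → Fin (N S) →
                  InInterior S origin
origin-interior S barycentre spanning n₀ with reciprocal n₀
... | u , u>0 , Nu≡1 = ε , ε>0 , inConv
  where
  ε : ℚ
  ε = u * ℚ.½
  ε>0 : 0ℚ < ε
  ε>0 = ℚP.positive⁻¹ ε {{ℚP.pos*pos⇒pos u {{ℚ.positive u>0}} ℚ.½}}
  inConv : ∀ y → Bounded ε y → InConv S y
  inConv y y-small =
    let (β , β-small , β-comb) = spanning (ℚP.<⇒≤ ε>0) y y-small
        open ShiftedWeights S Nu≡1 β
    in weight , weight≥0 (ℚP.<⇒≤ u>0) β-small , trans (sumFin≡sum (N S) weight) weight-sum ,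
       λ c → trans (sumFin≡sum (N S) _) (trans (weight-comb barycentre c) (β-comb c))

-- Coordinates of the prime-power cyclotomic points

module _ {p′ q : ℕ} where

  ppCoord-offBlock : ∀ {k k′ : Fin q} j (j′ : Fin p′) → k ≢ k′ → ppCoord (suc p′) k j k′ j′ ≡ ℤ.0ℤ
  ppCoord-offBlock {k} {k′} j j′ k≢k′ with k FinP.≟ k′
  ... | yes k≡k′ = ⊥-elim (k≢k′ k≡k′)
  ... | no  _    = refl

  ppCoord-last : ∀ (k : Fin q) (j′ : Fin p′) → ppCoord (suc p′) k (fromℕ p′) k j′ ≡ ℤ.-1ℤ
  ppCoord-last k j′ with k FinP.≟ k
  ... | no  k≢k = ⊥-elim (k≢k refl)
  ... | yes _ with Fin.toℕ (fromℕ p′) ℕ.≟ p′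
  ...   | yes _  = refl
  ...   | no  ≢p = ⊥-elim (≢p (FinP.toℕ-fromℕ p′))

  private
    inject₁≢last : ∀ (j : Fin p′) → Fin.toℕ (inject₁ j) ≢ p′
    inject₁≢last j = ≢-sym (FinP.toℕ-inject₁-≢ j)

  ppCoord-diag : ∀ (k : Fin q) (j′ : Fin p′) → ppCoord (suc p′) k (inject₁ j′) k j′ ≡ ℤ.1ℤ
  ppCoord-diag k j′ with k FinP.≟ k
  ... | no  k≢k = ⊥-elim (k≢k refl)
  ... | yes _ with Fin.toℕ (inject₁ j′) ℕ.≟ p′
  ...   | yes ≡p = ⊥-elim (inject₁≢last j′ ≡p)
  ...   | no  _ with Fin.toℕ (inject₁ j′) ℕ.≟ Fin.toℕ j′
  ...     | yes _  = refl
  ...     | no  ≢j = ⊥-elim (≢j (FinP.toℕ-inject₁ j′))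

  ppCoord-offDiag : ∀ (k : Fin q) {j j′ : Fin p′} → j ≢ j′ → ppCoord (suc p′) k (inject₁ j) k j′ ≡ ℤ.0ℤ
  ppCoord-offDiag k {j} {j′} j≢j′ with k FinP.≟ k
  ... | no  k≢k = ⊥-elim (k≢k refl)
  ... | yes _ with Fin.toℕ (inject₁ j) ℕ.≟ p′
  ...   | yes ≡p = ⊥-elim (inject₁≢last j ≡p)
  ...   | no  _ with Fin.toℕ (inject₁ j) ℕ.≟ Fin.toℕ j′
  ...     | yes ≡j = ⊥-elim (j≢j′ (FinP.toℕ-injective (trans (sym (FinP.toℕ-inject₁ j)) ≡j)))
  ...     | no  _  = refl

ppCoord-Is0±1 : ∀ p {q} (k : Fin q) j k′ j′ → Is0±1 (ppCoord p k j k′ j′)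
ppCoord-Is0±1 p k j k′ j′ with k FinP.≟ k′
... | no  _ = inj₁ refl
... | yes _ with Fin.toℕ j ℕ.≟ (p ℕ.∸ 1)
...   | yes _ = inj₂ (inj₂ refl)
...   | no  _ with Fin.toℕ j ℕ.≟ Fin.toℕ j′
...     | yes _ = inj₂ (inj₁ refl)
...     | no  _ = inj₁ refl

-- S is laid out like C_{p^α} ⊗ R with p = p′ + 1: points are indexed by (k, j, m) with
-- k < p^(α-1), j < p, and coordinates by (k, j′, c) with j′ < p - 1.  C_{p^α} itself is
-- C_{p^α} ⊗ One.

record PrimePowerTensor (p′ : ℕ) (R S : PointSet) : Set where
  field
    q             : ℕ
    k₀            : Fin q
    index         : Fin q → Fin (suc p′) → Fin (N R) → Fin (N S)
    coord         : Fin q → Fin p′ → Fin (d R) → Fin (d S)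
    unindex       : Fin (N S) → Fin q × Fin (suc p′) × Fin (N R)
    uncoord       : Fin (d S) → Fin q × Fin p′ × Fin (d R)
    unindex-index : ∀ k j m → unindex (index k j m) ≡ (k , j , m)
    index-unindex : ∀ n → let (k , j , m) = unindex n in index k j m ≡ n
    coord-uncoord : ∀ c → let (k , j , c′) = uncoord c in coord k j c′ ≡ c
    point-index   : ∀ k j m k′ j′ c →
                    point S (index k j m) (coord k′ j′ c) ≡ ppCoord (suc p′) k j k′ j′ ℤ.* point R m c
    sum-index     : ∀ (F : Fin (N S) → ℚ) →
                    sum F ≡ sum {q} λ k → sum {suc p′} λ j → sum {N R} λ m → F (index k j m)

One : PointSet
One = record { N = 1 ; d = 1 ; point = λ _ _ → ℤ.1ℤ }

⊗-point : ∀ P Q (a : Fin (N P)) (m : Fin (N Q)) (b : Fin (d P)) (c : Fin (d Q)) →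
          point (P ⊗ Q) (combine a m) (combine b c) ≡ point P a b ℤ.* point Q m c
⊗-point P Q a m b c = cong₂ (λ (a , m) (b , c) → point P a b ℤ.* point Q m c)
  (FinP.remQuot-combine a m) (FinP.remQuot-combine b c)

module _ (p′ α : ℕ) where

  private
    q : ℕ
    q = suc p′ ℕ.^ (α ℕ.∸ 1)
    C : PointSet
    C = primePowerPoly (suc p′) α

    k₀ : Fin q
    k₀ = Fin.fromℕ< (ℕP.m^n>0 (suc p′) (α ℕ.∸ 1))

    C-point : ∀ (k : Fin q) (j : Fin (suc p′)) (k′ : Fin q) (j′ : Fin p′) →
              point C (combine k j) (combine k′ j′) ≡ ppCoord (suc p′) k j k′ j′
    C-point k j k′ j′ = cong₂ (λ (k , j) (k′ , j′) → ppCoord (suc p′) k j k′ j′)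
      (FinP.remQuot-combine k j) (FinP.remQuot-combine k′ j′)

  primePowerTensor : PrimePowerTensor p′ One C
  primePowerTensor = record
    { q             = q
    ; k₀            = k₀
    ; index         = λ k j _ → combine k j
    ; coord         = λ k j _ → combine k j
    ; unindex       = λ n → let (k , j) = remQuot {q} (suc p′) n in k , j , zero
    ; uncoord       = λ c → let (k , j) = remQuot {q} p′ c in k , j , zero
    ; unindex-index = λ { k j zero → cong (λ (k , j) → k , j , zero) (FinP.remQuot-combine k j) }
    ; index-unindex = FinP.combine-remQuot {q} (suc p′)
    ; coord-uncoord = FinP.combine-remQuot {q} p′
    ; point-index   = λ k j _ k′ j′ _ → trans (C-point k j k′ j′) (sym (ℤP.*-identityʳ _))
    ; sum-index     = λ F → trans (sum-combine q {suc p′} F) (sum-cong-≗ λ k → sum-cong-≗ λ j →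
                                sym (ℚP.+-identityʳ (F (combine {q} {suc p′} k j))))
    }

  tensor : ∀ R → PrimePowerTensor p′ R (C ⊗ R)
  tensor R = record
    { q             = q
    ; k₀            = k₀
    ; index         = λ k j m → combine (combine k j) m
    ; coord         = λ k j c → combine (combine k j) c
    ; unindex       = λ n → let (a , m) = remQuot {q ℕ.* suc p′} (N R) n
                                (k , j) = remQuot {q} (suc p′) a in k , j , m
    ; uncoord       = λ c → let (b , c′) = remQuot {q ℕ.* p′} (d R) c
                                (k , j)  = remQuot {q} p′ b in k , j , c′
    ; unindex-index = λ k j m → trans
        (cong (λ (a , m) → let (k , j) = remQuot {q} (suc p′) a in k , j , m)
              (FinP.remQuot-combine (combine k j) m))
        (cong (λ (k , j) → k , j , m) (FinP.remQuot-combine k j))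
    ; index-unindex = λ n → let (a , m) = remQuot {q ℕ.* suc p′} (N R) n in
        trans (cong (λ a → combine a m) (FinP.combine-remQuot {q} (suc p′) a))
              (FinP.combine-remQuot {q ℕ.* suc p′} (N R) n)
    ; coord-uncoord = λ c → let (b , c′) = remQuot {q ℕ.* p′} (d R) c in
        trans (cong (λ b → combine b c′) (FinP.combine-remQuot {q} p′ b))
              (FinP.combine-remQuot {q ℕ.* p′} (d R) c)
    ; point-index   = λ k j m k′ j′ c → trans (⊗-point C R (combine k j) m (combine k′ j′) c)
                                          (cong (ℤ._* point R m c) (C-point k j k′ j′))
    ; sum-index     = λ F → trans (sum-combine (q ℕ.* suc p′) {N R} F) (sum-combine q {suc p′} _)
    }

record Invariants (S : PointSet) : Set where
  field
    unitCoordinates : UnitCoordinates S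
    nonzeroPoints   : NonzeroPoints S
    unitMassRigid   : UnitMassRigid S
    spanning        : BoundedSpanning S
    somePoint       : Fin (N S)

module Tensor {p′ : ℕ} {R S : PointSet} (T : PrimePowerTensor p′ R S) where
  open PrimePowerTensor T

  last : Fin (suc p′)
  last = fromℕ p′

  index-elim : {P : Fin (N S) → Set} → (∀ k j m → P (index k j m)) → ∀ n → P n
  index-elim {P} h n = subst P (index-unindex n) (h _ _ _)

  coord-elim : {P : Fin (d S) → Set} → (∀ k j c → P (coord k j c)) → ∀ c → P c
  coord-elim {P} h c = subst P (coord-uncoord c) (h _ _ _)

  blockComb : (Fin (N S) → ℚ) → Fin q → Fin (suc p′) → Fin (d R) → ℚ
  blockComb L k j = lincomb R (λ m → L (index k j m))

  point-indexℚ : ∀ k j m k′ j′ c → toℚ (point S (index k j m) (coord k′ j′ c)) ≡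
                 toℚ (ppCoord (suc p′) k j k′ j′) * toℚ (point R m c)
  point-indexℚ k j m k′ j′ c =
    trans (cong toℚ (point-index k j m k′ j′ c)) (toℚ-homo-* (ppCoord (suc p′) k j k′ j′) (point R m c))

  lincomb-coord : ∀ L k′ j′ c →
                  lincomb S L (coord k′ j′ c) ≡ blockComb L k′ (inject₁ j′) c - blockComb L k′ last c
  lincomb-coord L k′ j′ c = begin
    lincomb S L (coord k′ j′ c)
      ≡⟨ sum-index (λ n → L n * toℚ (point S n (coord k′ j′ c))) ⟩
    sum (λ k → sum (λ j → sum (λ m → L (index k j m) * toℚ (point S (index k j m) (coord k′ j′ c)))))
      ≡⟨ sum-cong-≗ (λ k → sum-cong-≗ (λ j → block k j)) ⟩
    sum (λ k → sum (λ j → g k j))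
      ≡⟨ sum-single k′ (λ k k≢k′ → trans (sum-cong-≗ (λ j → offBlock k≢k′ j)) (sum-replicate-zero (suc p′))) ⟩
    sum (g k′)
      ≡⟨ sum-init-last (g k′) ⟩
    sum (λ j → g k′ (inject₁ j)) + g k′ last
      ≡⟨ cong (_+ g k′ last) (sum-single j′ (λ j j≢j′ → onBlock k′ (inject₁ j) (ppCoord-offDiag k′ j≢j′))) ⟩
    g k′ (inject₁ j′) + g k′ last
      ≡⟨ cong₂ (λ a b → toℚ a * W (inject₁ j′) + toℚ b * W last) (ppCoord-diag k′ j′) (ppCoord-last k′ j′) ⟩
    1ℚ * W (inject₁ j′) + - 1ℚ * W last
      ≡⟨ solve 2 (λ x y → con 1ℚ :* x :+ :- con 1ℚ :* y := x :- y) refl (W (inject₁ j′)) (W last) ⟩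
    W (inject₁ j′) - W last
      ∎
    where
    open ≡-Reasoning
    W : Fin (suc p′) → ℚ
    W j = blockComb L k′ j c
    pp : Fin q → Fin (suc p′) → ℚ
    pp k j = toℚ (ppCoord (suc p′) k j k′ j′)
    g : Fin q → Fin (suc p′) → ℚ
    g k j = pp k j * blockComb L k j c
    block : ∀ k j → sum (λ m → L (index k j m) * toℚ (point S (index k j m) (coord k′ j′ c))) ≡ g k j
    block k j = trans
      (sum-cong-≗ (λ m → trans (cong (L (index k j m) *_) (point-indexℚ k j m k′ j′ c))
        (solve 3 (λ l a v → l :* (a :* v) := a :* l :* v) refl
                 (L (index k j m)) (pp k j) (toℚ (point R m c)))))
      (lincomb-* R (pp k j) (λ m → L (index k j m)) c)
    onBlock : ∀ k j → ppCoord (suc p′) k j k′ j′ ≡ ℤ.0ℤ → g k j ≡ 0ℚ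
    onBlock k j pp≡0 = trans (cong (λ a → toℚ a * blockComb L k j c) pp≡0) (ℚP.*-zeroˡ (blockComb L k j c))
    offBlock : ∀ {k} → k ≢ k′ → ∀ j → g k j ≡ 0ℚ
    offBlock {k} k≢k′ j = onBlock k j (ppCoord-offBlock j j′ k≢k′)

  barycentre : ∀ c → lincomb S (λ _ → 1ℚ) c ≡ 0ℚ
  barycentre = coord-elim λ k j c →
    trans (lincomb-coord (λ _ → 1ℚ) k j c) (ℚP.+-inverseʳ (lincomb R (λ _ → 1ℚ) c))

  unitCoordinates : UnitCoordinates R → UnitCoordinates S
  unitCoordinates unitR = index-elim λ k j m → coord-elim λ k′ j′ c →
    subst Is0±1 (sym (point-index k j m k′ j′ c)) (Is0±1-* (ppCoord-Is0±1 (suc p′) k j k′ j′) (unitR m c))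

  nonzeroPoints : Fin p′ → NonzeroPoints R → NonzeroPoints S
  nonzeroPoints j₀ nonzeroR = index-elim nonzeroAt
    where
    witness : ∀ k j m k′ j′ → ppCoord (suc p′) k j k′ j′ ≢ ℤ.0ℤ → ∃[ c ] point S (index k j m) c ≢ ℤ.0ℤ
    witness k j m k′ j′ pp≢0 = coord k′ j′ (proj₁ (nonzeroR m)) , λ eq →
      [ pp≢0 , proj₂ (nonzeroR m) ]′ (ℤP.i*j≡0⇒i≡0∨j≡0 _ (trans (sym (point-index k j m k′ j′ _)) eq))

    nonzeroAt : ∀ k j m → ∃[ c ] point S (index k j m) c ≢ ℤ.0ℤ
    nonzeroAt k j m with view j
    ... | ‵fromℕ      = witness k last m k j₀ (subst (_≢ ℤ.0ℤ) (sym (ppCoord-last k j₀)) (λ ()))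
    ... | ‵inject₁ j′ = witness k (inject₁ j′) m k j′ (subst (_≢ ℤ.0ℤ) (sym (ppCoord-diag k j′)) (λ ()))

  somePoint : Fin (N R) → Fin (N S)
  somePoint = index k₀ zero

  -- Block (k, j) for j < p - 1 carries a short representation of y's block (k, j); the last
  -- block of each k carries nothing, so lincomb-coord returns exactly y.
  spanning : BoundedSpanning R → BoundedSpanning S
  spanning spanR {ε} ε≥0 y y-small = β , β-small , β-comb
    where
    spanBlock : ∀ k j → Σ[ γ ∈ (Fin (N R) → ℚ) ] Bounded ε γ × (∀ c → lincomb R γ c ≡ y (coord k j c))
    spanBlock k j = spanR ε≥0 (λ c → y (coord k j c)) (λ c → y-small (coord k j c))

    γ : Fin q → Fin (suc p′) → Fin (N R) → ℚ
    γ k j m with view j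
    ... | ‵fromℕ      = 0ℚ
    ... | ‵inject₁ j′ = proj₁ (spanBlock k j′) m

    γ-last : ∀ k m → γ k last m ≡ 0ℚ
    γ-last k m rewrite view-fromℕ p′ = refl

    γ-inject₁ : ∀ k j m → γ k (inject₁ j) m ≡ proj₁ (spanBlock k j) m
    γ-inject₁ k j m rewrite view-inject₁ j = refl

    γ-small : ∀ k j → Bounded ε (γ k j)
    γ-small k j m with view j
    ... | ‵fromℕ      = subst (_≤ 0ℚ) (sym (ℚP.+-identityˡ (- ε))) (ℚP.neg-antimono-≤ ε≥0)
                        , subst (0ℚ ≤_) (sym (ℚP.+-identityˡ ε)) ε≥0
    ... | ‵inject₁ j′ = proj₁ (proj₂ (spanBlock k j′)) m

    β : Fin (N S) → ℚ
    β n = let (k , j , m) = unindex n in γ k j m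

    β-index : ∀ k j m → β (index k j m) ≡ γ k j m
    β-index k j m = cong (λ (k , j , m) → γ k j m) (unindex-index k j m)

    β-small : Bounded ε β
    β-small = index-elim λ k j m →
      subst (λ b → (0ℚ - ε ≤ b) × (b ≤ 0ℚ + ε)) (sym (β-index k j m)) (γ-small k j m)

    β-comb : ∀ c → lincomb S β c ≡ y c
    β-comb = coord-elim λ k j c → begin
      lincomb S β (coord k j c)                            ≡⟨ lincomb-coord β k j c ⟩
      blockComb β k (inject₁ j) c - blockComb β k last c   ≡⟨ cong₂ _-_ (filled k j c) (empty k c) ⟩
      y (coord k j c) - 0ℚ                                 ≡⟨ ℚP.+-identityʳ _ ⟩
      y (coord k j c)                                      ∎
      where
      open ≡-Reasoning
      filled : ∀ k j c → blockComb β k (inject₁ j) c ≡ y (coord k j c)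
      filled k j c = trans (lincomb-cong R (λ m → trans (β-index k (inject₁ j) m) (γ-inject₁ k j m)) c)
                           (proj₂ (proj₂ (spanBlock k j)) c)
      empty : ∀ k c → blockComb β k last c ≡ 0ℚ
      empty k c = trans (lincomb-cong R (λ m → trans (β-index k last m) (γ-last k m)) c)
                        (lincomb-zero R c)

  module BlockMasses {lp lm t y} (comb : SignedComb S lp lm t y) where
    open SignedComb comb

    L : Fin (N S) → ℚ
    L n = lp n - lm n

    W : Fin q → Fin (suc p′) → Fin (d R) → ℚ
    W = blockComb L

    blockMass : Fin q → Fin (suc p′) → ℚ
    blockMass k j = sum (λ m → lp (index k j m) + lm (index k j m))

    rowMass : Fin q → ℚ
    rowMass k = sum (blockMass k)

    blockMass≥0 : ∀ k j → 0ℚ ≤ blockMass k j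
    blockMass≥0 k j = sum-nonneg (λ m → ℚP.+-mono-≤ (lp≥0 (index k j m)) (lm≥0 (index k j m)))

    rowMass≥0 : ∀ k → 0ℚ ≤ rowMass k
    rowMass≥0 k = sum-nonneg (blockMass≥0 k)

    totalMass : sum rowMass ≡ t
    totalMass = trans (sym (sum-index (λ n → lp n + lm n))) mass

    y-coord : ∀ k j c → y (coord k j c) ≡ W k (inject₁ j) c - W k last c
    y-coord k j c = trans (sym (represents (coord k j c))) (lincomb-coord L k j c)

    pairPos pairNeg : Fin q → Fin (suc p′) → Fin (suc p′) → Fin (N R) → ℚ
    pairPos k a b m = lp (index k a m) + lm (index k b m)
    pairNeg k a b m = lm (index k a m) + lp (index k b m)

    pairComb : ∀ k a b → SignedComb R (pairPos k a b) (pairNeg k a b)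
                                      (blockMass k a + blockMass k b) (λ c → W k a c - W k b c)
    pairComb k a b = record
      { lp≥0       = λ m → ℚP.+-mono-≤ (lp≥0 (index k a m)) (lm≥0 (index k b m))
      ; lm≥0       = λ m → ℚP.+-mono-≤ (lm≥0 (index k a m)) (lp≥0 (index k b m))
      ; mass       = trans (sum-cong-≗ (λ m → regroup (pa m) (ma m) (pb m) (mb m)))
                           (∑-distrib-+ (λ m → pa m + ma m) (λ m → pb m + mb m))
      ; represents = λ c → trans (lincomb-cong R (λ m → regroup′ (pa m) (ma m) (pb m) (mb m)) c)
                                 (lincomb-- R (λ m → pa m - ma m) (λ m → pb m - mb m) c)
      }
      where
      pa ma pb mb : Fin (N R) → ℚ
      pa m = lp (index k a m)
      ma m = lm (index k a m)
      pb m = lp (index k b m)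
      mb m = lm (index k b m)
      regroup : ∀ pa ma pb mb → (pa + mb) + (ma + pb) ≡ (pa + ma) + (pb + mb)
      regroup = solve 4 (λ pa ma pb mb → (pa :+ mb) :+ (ma :+ pb) := (pa :+ ma) :+ (pb :+ mb)) refl
      regroup′ : ∀ pa ma pb mb → (pa + mb) - (ma + pb) ≡ (pa - ma) - (pb - mb)
      regroup′ = solve 4 (λ pa ma pb mb → (pa :+ mb) :- (ma :+ pb) := (pa :- ma) :- (pb :- mb)) refl

    emptyBlock : ∀ {k j} → blockMass k j ≡ 0ℚ → ∀ m → lp (index k j m) ≡ 0ℚ × lm (index k j m) ≡ 0ℚ
    emptyBlock {k} {j} mass≡0 m = nonneg-+≤0 (lp≥0 (index k j m)) (lm≥0 (index k j m))
      (subst (_ ≤_) mass≡0 (term≤sum (λ m → ℚP.+-mono-≤ (lp≥0 (index k j m)) (lm≥0 (index k j m))) m))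

    emptyBlock-W : ∀ {k j} → blockMass k j ≡ 0ℚ → ∀ c → W k j c ≡ 0ℚ
    emptyBlock-W mass≡0 c = trans (lincomb-cong R (λ m → let (lp≡0 , lm≡0) = emptyBlock mass≡0 m in
                                                      cong₂ _-_ lp≡0 lm≡0) c)
                                  (lincomb-zero R c)

  -- Fix a mass-one representation of a lattice point w with w (coord k j c₀) ≠ 0.  Blocks
  -- a = inject₁ j and b = last of row k already carry mass ≥ 1, so every other block is empty,
  -- and rigidity of R applies to the combination that blocks a and b induce on R.
  module Rigidity (unitR : UnitCoordinates R) (rigidR : UnitMassRigid R)
                  {lp lm y} (w : Fin (d S) → ℤ) (comb : SignedComb S lp lm 1ℚ y)
                  (y≡w : ∀ c → y c ≡ toℚ (w c))
                  (k : Fin q) (j : Fin p′) (c₀ : Fin (d R)) (w≢0 : w (coord k j c₀) ≢ ℤ.0ℤ) where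
    open SignedComb comb using (lp≥0; lm≥0)
    open BlockMasses comb

    a b : Fin (suc p′)
    a = inject₁ j
    b = last

    a≢b : a ≢ b
    a≢b = ≢-sym FinP.fromℕ≢inject₁

    a≢inject₁ : ∀ {j′} → j ≢ j′ → a ≢ inject₁ j′
    a≢inject₁ j≢j′ = j≢j′ ∘ FinP.inject₁-injective

    w-coord : ∀ k′ j′ c → W k′ (inject₁ j′) c - W k′ last c ≡ toℚ (w (coord k′ j′ c))
    w-coord k′ j′ c = trans (sym (y-coord k′ j′ c)) (y≡w (coord k′ j′ c))

    pairMass≥1 : ∀ a′ b′ c {z} → W k a′ c - W k b′ c ≡ toℚ z → z ≢ ℤ.0ℤ →
                 1ℚ ≤ blockMass k a′ + blockMass k b′
    pairMass≥1 a′ b′ c = mass≥1 unitR (pairComb k a′ b′) c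

    ab≥1 : 1ℚ ≤ blockMass k a + blockMass k b
    ab≥1 = pairMass≥1 a b c₀ (w-coord k j c₀) w≢0

    row≤1 : rowMass k ≤ 1ℚ
    row≤1 = ℚP.≤-trans (term≤sum rowMass≥0 k) (ℚP.≤-reflexive totalMass)

    ab≡1 : blockMass k a + blockMass k b ≡ 1ℚ
    ab≡1 = ℚP.≤-antisym (ℚP.≤-trans (pair≤sum (blockMass≥0 k) a≢b) row≤1) ab≥1

    otherRow≡0 : ∀ {k′} → k ≢ k′ → ∀ j′ → blockMass k′ j′ ≡ 0ℚ
    otherRow≡0 {k′} k≢k′ j′ = ℚP.≤-antisym
      (ℚP.≤-trans (term≤sum (blockMass≥0 k′) j′) (ℚP.≤-reflexive row′≡0)) (blockMass≥0 k′ j′)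
      where
      total≤row : sum rowMass ≤ rowMass k
      total≤row = ℚP.≤-trans (ℚP.≤-reflexive totalMass)
                             (ℚP.≤-trans ab≥1 (pair≤sum (blockMass≥0 k) a≢b))
      row′≡0 : rowMass k′ ≡ 0ℚ
      row′≡0 = sum≤term⇒rest≡0 rowMass≥0 total≤row k′ k≢k′

    otherColumn≡0 : ∀ {j′} → j ≢ j′ → blockMass k (inject₁ j′) ≡ 0ℚ
    otherColumn≡0 j≢j′ = sum≤pair⇒rest≡0 (blockMass≥0 k) a≢b (ℚP.≤-trans row≤1 ab≥1) _
      (a≢inject₁ j≢j′) FinP.fromℕ≢inject₁

    a-empty : 1ℚ ≤ blockMass k b → blockMass k a ≡ 0ℚ
    a-empty 1≤b = ℚP.≤-antisym
      (p+q≤p⇒q≤0 (subst (_≤ blockMass k b) (ℚP.+-comm (blockMass k a) (blockMass k b))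
                                            (ℚP.≤-trans (ℚP.≤-reflexive ab≡1) 1≤b)))
      (blockMass≥0 k a)

    b-empty : 1ℚ ≤ blockMass k a → blockMass k b ≡ 0ℚ
    b-empty 1≤a = ℚP.≤-antisym (p+q≤p⇒q≤0 (ℚP.≤-trans (ℚP.≤-reflexive ab≡1) 1≤a)) (blockMass≥0 k b)

    w-offRow : ∀ {k′} → k ≢ k′ → ∀ j′ c → w (coord k′ j′ c) ≡ ℤ.0ℤ
    w-offRow {k′} k≢k′ j′ c = toℚ-injective (begin
      toℚ (w (coord k′ j′ c))                   ≡⟨ w-coord k′ j′ c ⟨
      W k′ (inject₁ j′) c - W k′ last c         ≡⟨ cong₂ _-_ (emptyBlock-W (otherRow≡0 k≢k′ _) c)
                                                             (emptyBlock-W (otherRow≡0 k≢k′ _) c) ⟩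
      0ℚ - 0ℚ                                   ∎)
      where open ≡-Reasoning

    -- A nonzero entry in column j′ ≠ j puts mass 1 on the blocks inject₁ j′ (empty) and b.
    w-offColumn : blockMass k a ≢ 0ℚ → ∀ {j′} → j ≢ j′ → ∀ c → w (coord k j′ c) ≡ ℤ.0ℤ
    w-offColumn a≢0 {j′} j≢j′ c with w (coord k j′ c) ℤ.≟ ℤ.0ℤ
    ... | yes w′≡0 = w′≡0
    ... | no  w′≢0 = ⊥-elim (a≢0 (a-empty 1≤b))
      where
      1≤b : 1ℚ ≤ blockMass k b
      1≤b = subst (1ℚ ≤_) (trans (cong (_+ blockMass k b) (otherColumn≡0 j≢j′)) (ℚP.+-identityˡ _))
                  (pairMass≥1 (inject₁ j′) b c (w-coord k j′ c) w′≢0)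

    -- Columns j and j′ ≠ j differ only if the blocks a and inject₁ j′ (empty) carry mass 1.
    w-column : blockMass k b ≢ 0ℚ → ∀ j′ c → w (coord k j′ c) ≡ w (coord k j c)
    w-column b≢0 j′ c with j FinP.≟ j′
    ... | yes refl = refl
    ... | no  j≢j′ with w (coord k j c) ℤ.≟ w (coord k j′ c)
    ...   | yes w≡w′ = sym w≡w′
    ...   | no  w≢w′ = ⊥-elim (b≢0 (b-empty 1≤a))
      where
      open ≡-Reasoning
      difference : W k a c - W k (inject₁ j′) c ≡ toℚ (w (coord k j c) ℤ.- w (coord k j′ c))
      difference = begin
        W k a c - W k (inject₁ j′) c
          ≡⟨ solve 3 (λ x x′ z → x :- x′ := (x :- z) :- (x′ :- z)) refl
                     (W k a c) (W k (inject₁ j′) c) (W k b c) ⟩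
        (W k a c - W k b c) - (W k (inject₁ j′) c - W k b c)
          ≡⟨ cong₂ _-_ (w-coord k j c) (w-coord k j′ c) ⟩
        toℚ (w (coord k j c)) - toℚ (w (coord k j′ c))
          ≡⟨ cong (toℚ (w (coord k j c)) +_) (toℚ-homo-neg (w (coord k j′ c))) ⟨
        toℚ (w (coord k j c)) + toℚ (ℤ.- w (coord k j′ c))
          ≡⟨ toℚ-homo-+ (w (coord k j c)) (ℤ.- w (coord k j′ c)) ⟨
        toℚ (w (coord k j c) ℤ.- w (coord k j′ c))
          ∎
      1≤a : 1ℚ ≤ blockMass k a
      1≤a = subst (1ℚ ≤_) (trans (cong (blockMass k a +_) (otherColumn≡0 j≢j′)) (ℚP.+-identityʳ _))
                  (pairMass≥1 a (inject₁ j′) c difference (w≢w′ ∘ ℤP.i-j≡0⇒i≡j _ _))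

    pairComb₁ : SignedComb R (pairPos k a b) (pairNeg k a b) 1ℚ (λ c → W k a c - W k b c)
    pairComb₁ = subst (λ t → SignedComb R (pairPos k a b) (pairNeg k a b) t (λ c → W k a c - W k b c))
                      ab≡1 (pairComb k a b)

    summand≢0 : ∀ {p q} → 0ℚ ≤ p → 0ℚ ≤ q → p ≢ 0ℚ → p + q ≢ 0ℚ
    summand≢0 p≥0 q≥0 p≢0 p+q≡0 = p≢0 (proj₁ (nonneg-+≤0 p≥0 q≥0 (ℚP.≤-reflexive p+q≡0)))

    nonempty : ∀ {j′ m} → lp (index k j′ m) ≢ 0ℚ → blockMass k j′ ≢ 0ℚ
    nonempty lp≢0 mass≡0 = lp≢0 (proj₁ (emptyBlock mass≡0 _))

    R-point-a : ∀ m → lp (index k a m) ≢ 0ℚ → ∀ c → point R m c ≡ w (coord k j c)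
    R-point-a m lp≢0 = rigidR (λ c → w (coord k j c)) pairComb₁ (w-coord k j) c₀ w≢0 m
                         (summand≢0 (lp≥0 _) (lm≥0 _) lp≢0)

    R-point-b : ∀ m → lp (index k b m) ≢ 0ℚ → ∀ c → ℤ.- point R m c ≡ w (coord k j c)
    R-point-b m lp≢0 = UnitMassRigid-neg rigidR (λ c → w (coord k j c)) pairComb₁ (w-coord k j) c₀ w≢0 m
                         (subst (_≢ 0ℚ) (ℚP.+-comm (lp (index k b m)) (lm (index k a m)))
                                (summand≢0 (lp≥0 (index k b m)) (lm≥0 (index k a m)) lp≢0))

    point-a : ∀ m → lp (index k a m) ≢ 0ℚ → ∀ c′ → point S (index k a m) c′ ≡ w c′
    point-a m lp≢0 = coord-elim λ k′ j′ c → trans (point-index k a m k′ j′ c) (value k′ j′ c)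
      where
      value : ∀ k′ j′ c → ppCoord (suc p′) k a k′ j′ ℤ.* point R m c ≡ w (coord k′ j′ c)
      value k′ j′ c with k′ FinP.≟ k
      ... | no  k′≢k = trans (cong (ℤ._* point R m c) (ppCoord-offBlock a j′ (≢-sym k′≢k)))
                             (sym (w-offRow (≢-sym k′≢k) j′ c))
      ... | yes refl with j′ FinP.≟ j
      ...   | yes refl = trans (cong (ℤ._* point R m c) (ppCoord-diag k j))
                               (trans (ℤP.*-identityˡ (point R m c)) (R-point-a m lp≢0 c))
      ...   | no  j′≢j = trans (cong (ℤ._* point R m c) (ppCoord-offDiag k (≢-sym j′≢j)))
                               (sym (w-offColumn (nonempty lp≢0) (≢-sym j′≢j) c))

    point-b : ∀ m → lp (index k b m) ≢ 0ℚ → ∀ c′ → point S (index k b m) c′ ≡ w c′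
    point-b m lp≢0 = coord-elim λ k′ j′ c → trans (point-index k b m k′ j′ c) (value k′ j′ c)
      where
      value : ∀ k′ j′ c → ppCoord (suc p′) k b k′ j′ ℤ.* point R m c ≡ w (coord k′ j′ c)
      value k′ j′ c with k′ FinP.≟ k
      ... | no  k′≢k = trans (cong (ℤ._* point R m c) (ppCoord-offBlock b j′ (≢-sym k′≢k)))
                             (sym (w-offRow (≢-sym k′≢k) j′ c))
      ... | yes refl = trans (cong (ℤ._* point R m c) (ppCoord-last k j′))
                       (trans (ℤP.-1*i≡-i (point R m c))
                       (trans (R-point-b m lp≢0 c) (sym (w-column (nonempty lp≢0) j′ c))))

    rigid : ∀ n → lp n ≢ 0ℚ → ∀ c′ → point S n c′ ≡ w c′
    rigid = index-elim rigidAt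
      where
      rigidAt : ∀ k′ j′ m → lp (index k′ j′ m) ≢ 0ℚ → ∀ c′ → point S (index k′ j′ m) c′ ≡ w c′
      rigidAt k′ j′ m lp≢0 with k FinP.≟ k′
      ... | no  k≢k′ = ⊥-elim (lp≢0 (proj₁ (emptyBlock (otherRow≡0 k≢k′ j′) m)))
      ... | yes refl with view j′
      ...   | ‵fromℕ = point-b m lp≢0
      ...   | ‵inject₁ j″ with j FinP.≟ j″
      ...     | yes refl = point-a m lp≢0
      ...     | no  j≢j″ = ⊥-elim (lp≢0 (proj₁ (emptyBlock (otherColumn≡0 j≢j″) m)))

  unitMassRigid : UnitCoordinates R → UnitMassRigid R → UnitMassRigid S
  unitMassRigid unitR rigidR w comb y≡w = coord-elim λ k j c₀ w≢0 →
    Rigidity.rigid unitR rigidR w comb y≡w k j c₀ w≢0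

  step : Fin p′ → Invariants R → Invariants S × InInterior S origin
  step j₀ inv = invariants , origin-interior S barycentre (spanning I.spanning) (somePoint I.somePoint)
    where
    module I = Invariants inv
    invariants : Invariants S
    invariants = record
      { unitCoordinates = unitCoordinates I.unitCoordinates
      ; nonzeroPoints   = nonzeroPoints j₀ I.nonzeroPoints
      ; unitMassRigid   = unitMassRigid I.unitCoordinates I.unitMassRigid
      ; spanning        = spanning I.spanning
      ; somePoint       = somePoint I.somePoint
      }

One-unitCoordinates : UnitCoordinates One
One-unitCoordinates _ _ = inj₂ (inj₁ refl)

One-unitMassRigid : UnitMassRigid One
One-unitMassRigid {lp} {lm} w comb y≡w zero w≢0 zero lp≢0 zero with nonzero⇒1≤±toℚ w≢0
... | inj₁ 1≤w  =
  toℚ-injective (ℚP.≤-antisym 1≤w (subst (_≤ 1ℚ) (y≡w zero) (coord≤mass One-unitCoordinates comb zero)))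
... | inj₂ 1≤-w = ⊥-elim (lp≢0 (proj₁ (nonneg-+≤0 (lp≥0 zero) (lp≥0 zero) lp+lp≤0)))
  where
  open SignedComb comb
  open ℚP.≤-Reasoning
  x : ℚ
  x = toℚ (w zero)
  lp+lp≤0 : lp zero + lp zero ≤ 0ℚ
  lp+lp≤0 = begin
    lp zero + lp zero
      ≡⟨ solve 2 (λ p m → p :+ p := (p :+ m :+ con 0ℚ) :+ ((p :- m) :* con 1ℚ :+ con 0ℚ)) refl
                 (lp zero) (lm zero) ⟩
    (lp zero + lm zero + 0ℚ) + ((lp zero - lm zero) * 1ℚ + 0ℚ)
      ≡⟨ cong₂ _+_ mass (trans (represents zero) (y≡w zero)) ⟩
    1ℚ + x
      ≤⟨ ℚP.+-monoˡ-≤ x 1≤-w ⟩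
    - x + x
      ≡⟨ ℚP.+-inverseˡ x ⟩
    0ℚ
      ∎

One-invariants : Invariants One
One-invariants = record
  { unitCoordinates = One-unitCoordinates
  ; nonzeroPoints   = λ _ → zero , λ ()
  ; unitMassRigid   = One-unitMassRigid
  ; spanning        = λ _ y y-small →
                        y , y-small , λ { zero → trans (ℚP.+-identityʳ _) (ℚP.*-identityʳ (y zero)) }
  ; somePoint       = zero
  }

conclusion : ∀ {S} → Invariants S → InInterior S origin → CyclotomicConclusion S
conclusion {S} inv interior = vertex-coords , latticePoints , origin-notVertex nonzeroPoints , interior
  where
  open Invariants inv
  vertex-coords : ∀ x → IsVertex S x → ∀ c → x c ≡ 0ℚ ⊎ x c ≡ 1ℚ ⊎ x c ≡ - 1ℚ
  vertex-coords x vertex c = let (n , n≡x) = vertex⇒point {S} vertex in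
    subst (λ v → v ≡ 0ℚ ⊎ v ≡ 1ℚ ⊎ v ≡ - 1ℚ) (n≡x c) (toℚ-Is0±1 (unitCoordinates n c))
  latticePoints : ∀ z → InConv S (latticeToℚ z) → ¬ IsVertex S (latticeToℚ z) → ∀ c → z c ≡ ℤ.0ℤ
  latticePoints z inConv notVertex c with z c ℤ.≟ ℤ.0ℤ
  ... | yes z≡0 = z≡0
  ... | no  z≢0 = ⊥-elim (notVertex (nonzeroLatticePoint-isVertex unitMassRigid z inConv c z≢0))

cyclotomic-invariants : ∀ f fs → All ValidFactor (f ∷ fs) →
                        Invariants (cyclotomic f fs) × InInterior (cyclotomic f fs) origin
cyclotomic-invariants (0 , _)              _        ((p-prime , _) ∷ _) = ⊥-elim (¬prime[0] p-prime)
cyclotomic-invariants (1 , _)              _        ((p-prime , _) ∷ _) = ⊥-elim (¬prime[1] p-prime)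
cyclotomic-invariants (suc (suc p″) , α)   []       _                   =
  Tensor.step (primePowerTensor (suc p″) α) zero One-invariants
cyclotomic-invariants (suc (suc p″) , α)   (g ∷ gs) (_ ∷ valid)         =
  Tensor.step (tensor (suc p″) α (cyclotomic g gs)) zero (proj₁ (cyclotomic-invariants g gs valid))

corollary2p7 : (m : ℕ) → 2 ℕ.≤ m →
    (f : ℕ × ℕ) (fs : List (ℕ × ℕ)) →
    All ValidFactor (f ∷ fs) →
    AllPairs _≢_ (map proj₁ (f ∷ fs)) →
    factorValue (f ∷ fs) ≡ m →
    CyclotomicConclusion (cyclotomic f fs)
corollary2p7 _ _ f fs valid _ _ =
  let (inv , interior) = cyclotomic-invariants f fs valid in conclusion inv interior
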